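{- For every $n\ge1$ and every permutation $\pi$ of $[n]$, $pbid(\pi)\ge\left\lceil\frac{b(\pi)-1}{3}\right\rceil$.
   Context: Permutations of $[n]=\{1,\dots,n\}$ are written as sequences $\pi=\langle\pi_1\,\pi_2\cdots\pi_n\rangle$ with $\pi_i=\pi(i)$; products are compositions applied right to left, so $(\pi\sigma)_i=\pi_{\sigma(i)}$; $\iota=\langle 1\,2\cdots n\rangle$ is the identity. For $1\le i<j\le k<\ell\le n+1$, the block-interchange $\beta(i,j,k,\ell)$ is the permutation $\langle 1\cdots i-1\;\; k\cdots \ell-1\;\; j\cdots k-1\;\; i\cdots j-1\;\; \ell\cdots n\rangle$, so that $\pi\beta(i,j,k,\ell)$ is obtained from $\pi$ by exchanging the blocks $\pi_i\cdots\pi_{j-1}$ and $\pi_k\cdots\pi_{\ell-1}$. A prefix block-interchange is a block-interchange with $i=1$. $pbid(\pi)$ denotes the minimum $t\ge 0$ such that there are prefix block-interchanges $\beta_1,\dots,\beta_t$ with $\pi\beta_1\cdots\beta_t=\iota$. Breakpoints: extend $\pi$ to $\langle \pi_0\,\pi_1\cdots\pi_n\,\pi_{n+1}\rangle$ with $\pi_0=0$, $\pi_{n+1}=n+1$; for $0\le i\le n$ the pair $(\pi_i,\pi_{i+1})$ is a breakpoint if $i=0$ or $\pi_{i+1}-\pi_i\neq1$. $b(\pi)$ is the number of breakpoints. -}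

module Defs where

open import Data.Nat using (ℕ; zero; suc; _+_; _∸_; _≤_; _<_; _≤ᵇ_; _<ᵇ_; _≡ᵇ_)
open import Data.Nat.DivMod using (_/_)
open import Data.Bool using (Bool; true; false; if_then_else_; _∨_; not)
open import Data.Fin using (Fin; toℕ; fromℕ<)
open import Data.Fin.Permutation using (Permutation′; _⟨$⟩ʳ_)
open import Data.List using (List; []; _∷_; foldl; length)
open import Relation.Nullary using (yes; no)
open import Data.Nat.Properties using (_<?_)

-- One-line sequence notation, 1-indexed positions.  Outside [1,n] we put p
-- (this makes π_0 = 0 and π_{n+1} = n+1, the extension used for breakpoints).
seq : {n : ℕ} → Permutation′ n → ℕ → ℕ
seq {n} π zero = zero
seq {n} π (suc q) with q <? n
... | yes q<n = suc (toℕ (π ⟨$⟩ʳ fromℕ< q<n))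
... | no _    = suc q

isBreakpoint : ℕ → ℕ → ℕ → Bool
isBreakpoint zero    x y = true
isBreakpoint (suc i) x y = not (y ≡ᵇ suc x)

countBP : (ℕ → ℕ) → ℕ → ℕ
countBP s zero    = zero
countBP s (suc m) =
  countBP s m + (if isBreakpoint m (s m) (s (suc m)) then 1 else 0)

b : {n : ℕ} → Permutation′ n → ℕ
b {n} π = countBP (seq π) (suc n)

-- The block-interchange β(i,j,k,ℓ) as a map on 1-indexed positions:
-- β(i,j,k,ℓ) = ⟨1 … i-1  k … ℓ-1  j … k-1  i … j-1  ℓ … n⟩,
-- i.e. the p-th entry of β is β p.
blockInterchange : ℕ → ℕ → ℕ → ℕ → ℕ → ℕ
blockInterchange i j k ℓ p =
  if p <ᵇ i then p
  else if p <ᵇ i + (ℓ ∸ k) then k + (p ∸ i)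
  else if p <ᵇ i + (ℓ ∸ k) + (k ∸ j) then j + (p ∸ (i + (ℓ ∸ k)))
  else if p <ᵇ ℓ then i + (p ∸ (i + (ℓ ∸ k) + (k ∸ j)))
  else p

record PrefixBI (n : ℕ) : Set where
  constructor pbi
  field
    j k ℓ : ℕ
    1<j   : 1 < j
    j≤k   : j ≤ k
    k<ℓ   : k < ℓ
    ℓ≤n+1 : ℓ ≤ suc n

toMap : {n : ℕ} → PrefixBI n → ℕ → ℕ
toMap (pbi j k ℓ _ _ _ _) = blockInterchange 1 j k ℓ

-- The sequence of π β₁ β₂ ⋯ β_t : (πβ₁⋯β_t)_p = π_{β₁(β₂(⋯β_t(p)))}
applyAll : {n : ℕ} → (ℕ → ℕ) → List (PrefixBI n) → ℕ → ℕ
applyAll f []       = f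
applyAll f (β ∷ βs) = applyAll (λ p → f (toMap β p)) βs

Sorts : {n : ℕ} → Permutation′ n → List (PrefixBI n) → Set
Sorts {n} π βs = (p : ℕ) → 1 ≤ p → p ≤ n → applyAll (seq π) βs p ≡ p
  where open import Relation.Binary.PropositionalEquality using (_≡_)

⌈_/3⌉ : ℕ → ℕ
⌈ m /3⌉ = (m + 2) / 3

module Submission where

-- Every prefix block-interchange destroys at most three breakpoints, while the
-- identity has exactly one (the mandatory breakpoint (π₀, π₁)); hence sorting π
-- with t prefix block-interchanges forces b(π) ≤ 1 + 3t, i.e. t ≥ ⌈(b(π)-1)/3⌉.
--
-- A prefix block-interchange β(1,j,k,ℓ) is described by its block lengths
-- A = j-1, B = k-j, C = ℓ-k and D = n+1-ℓ; it maps the blocks of lengths A, B, C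
-- of s onto blocks of lengths C, B, A of s∘β and fixes everything from ℓ on.
-- Comparing the four windows block by block gives b(s) ≤ b(s∘β) + 3, which is
-- iterated over the sorting sequence.

open import Defs
open import Data.Nat using (ℕ; _≤_; _∸_)
open import Data.Fin.Permutation using (Permutation′)
open import Data.List using (List; length)

open import Data.Nat using (zero; suc; _+_; _*_; _<_; _<ᵇ_; _≡ᵇ_; z≤n; s≤s; s≤s⁻¹)
open import Data.Nat.Properties
open import Data.Nat.DivMod using (m<n*o⇒m/o<n)
open import Data.Bool using (true; false; if_then_else_; not)
open import Data.Bool.Properties using (T-≡)
open import Data.List using ([]; _∷_)
open import Data.Product using (_,_)
open import Data.Sum using (inj₁; inj₂)
open import Data.Empty using (⊥-elim)
open import Function.Bundles using (Equivalence)
open import Relation.Nullary using (yes; no)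
open import Relation.Binary.PropositionalEquality
open import Data.Nat.Solver using (module +-*-Solver)
open +-*-Solver using (solve; _:+_; _:=_; con)

<ᵇ-true : ∀ {m n} → m < n → (m <ᵇ n) ≡ true
<ᵇ-true m<n = Equivalence.to T-≡ (<⇒<ᵇ m<n)

<ᵇ-false : ∀ {m n} → n ≤ m → (m <ᵇ n) ≡ false
<ᵇ-false {m}     {zero}  _         = refl
<ᵇ-false {suc m} {suc n} (s≤s n≤m) = <ᵇ-false n≤m

≡ᵇ-refl : ∀ x → (x ≡ᵇ x) ≡ true
≡ᵇ-refl x = Equivalence.to T-≡ (≡⇒≡ᵇ x x refl)

bp : (ℕ → ℕ) → ℕ → ℕ
bp s i = if isBreakpoint i (s i) (s (suc i)) then 1 else 0

bp≤1 : ∀ s i → bp s i ≤ 1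
bp≤1 s i with isBreakpoint i (s i) (s (suc i))
... | true  = ≤-refl
... | false = z≤n

bp-cong : ∀ s t x y → s (suc x) ≡ t (suc y) → s (suc (suc x)) ≡ t (suc (suc y)) →
  bp s (suc x) ≡ bp t (suc y)
bp-cong s t x y = cong₂ (λ u v → if not (v ≡ᵇ suc u) then 1 else 0)

window : (ℕ → ℕ) → ℕ → ℕ → ℕ
window s a zero    = 0
window s a (suc L) = window s a L + bp s (a + L)

countBP≡window : ∀ s m → countBP s m ≡ window s 0 m
countBP≡window s zero    = refl
countBP≡window s (suc m) = cong (_+ bp s m) (countBP≡window s m)

window-++ : ∀ s a L M → window s a (L + M) ≡ window s a L + window s (a + L) M
window-++ s a L zero    = trans (cong (window s a) (+-identityʳ L)) (sym (+-identityʳ _))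
window-++ s a L (suc M) = begin
    window s a (L + suc M)
  ≡⟨ cong (window s a) (+-suc L M) ⟩
    window s a (L + M) + bp s (a + (L + M))
  ≡⟨ cong₂ _+_ (window-++ s a L M) (cong (bp s) (sym (+-assoc a L M))) ⟩
    window s a L + window s (a + L) M + bp s (a + L + M)
  ≡⟨ +-assoc (window s a L) _ _ ⟩
    window s a L + window s (a + L) (suc M)
  ∎
  where open ≡-Reasoning

-- Position 0 always carries a breakpoint, so b counts 1 plus the breakpoints
-- at positions 1, …, n.
countBP-suc : ∀ s n → countBP s (suc n) ≡ suc (window s 1 n)
countBP-suc s n = trans (countBP≡window s (suc n)) (window-++ s 0 1 n)

Agree : (ℕ → ℕ) → ℕ → (ℕ → ℕ) → ℕ → ℕ → Set
Agree g a f c L = ∀ i → i < L → g (suc a + i) ≡ f (suc c + i)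

agree-tail : ∀ g a f c L → Agree g a f c (suc L) → Agree g (suc a) f (suc c) L
agree-tail g a f c L h i i<L =
  trans (cong g (cong suc (sym (+-suc a i))))
        (trans (h (suc i) (s≤s i<L)) (cong f (cong suc (+-suc c i))))

window-agree : ∀ g a f c L → Agree g a f c (suc L) →
  window g (suc a) L ≡ window f (suc c) L
window-agree g a f c zero    h = refl
window-agree g a f c (suc L) h =
  cong₂ _+_ (window-agree g a f c L (λ i i<L → h i (m<n⇒m<1+n i<L)))
            (bp-cong g f (a + L) (c + L) (h L (m<n⇒m<1+n (n<1+n L)))
                                         (agree-tail g a f c (suc L) h L ≤-refl))

-- If the agreement covers only the L positions themselves, the last pair is
-- uncontrolled and the counts may differ by one.
window-agree-≤ : ∀ g a f c L → Agree g a f c L →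
  window f (suc c) L ≤ window g (suc a) L + 1
window-agree-≤ g a f c zero    h = z≤n
window-agree-≤ g a f c (suc L) h = begin
    window f (suc c) L + bp f (suc c + L)
  ≤⟨ +-monoʳ-≤ (window f (suc c) L) (bp≤1 f _) ⟩
    window f (suc c) L + 1
  ≡⟨ cong (_+ 1) (sym (window-agree g a f c L h)) ⟩
    window g (suc a) L + 1
  ≤⟨ +-monoˡ-≤ 1 (m≤m+n _ _) ⟩
    window g (suc a) L + bp g (suc a + L) + 1
  ∎
  where open ≤-Reasoning

window-sorted : ∀ g a L → Agree g a (λ p → p) a (suc L) → window g (suc a) L ≡ 0
window-sorted g a L h = trans (window-agree g a (λ p → p) a L h) (no-breakpoints L)
  where
  no-breakpoints : ∀ L → window (λ p → p) (suc a) L ≡ 0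
  no-breakpoints zero    = refl
  no-breakpoints (suc L) rewrite no-breakpoints L | ≡ᵇ-refl (a + L) = refl

-- The exchange reverses the order of the three blocks.
reverse-sum : ∀ A B C → C + B + A ≡ A + B + C
reverse-sum = solve 3 (λ A B C → C :+ B :+ A := A :+ B :+ C) refl

exchange : ℕ → ℕ → ℕ → ℕ → ℕ
exchange A B C = blockInterchange 1 (suc A) (suc (A + B)) (suc (A + B + C))

exchange-second : ∀ A B C i → i < C → exchange A B C (suc i) ≡ suc (A + B + i)
exchange-second A B C i i<C
  rewrite m+n∸m≡n (A + B) C | <ᵇ-true i<C = refl

exchange-middle : ∀ A B C i → i < B → exchange A B C (suc (C + i)) ≡ suc (A + i)
exchange-middle A B C i i<B
  rewrite m+n∸m≡n (A + B) C | m+n∸m≡n A B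
        | <ᵇ-false (m≤m+n C i) | <ᵇ-true (+-monoʳ-< C i<B) | m+n∸m≡n C i = refl

exchange-first : ∀ A B C i → i < A → exchange A B C (suc (C + B + i)) ≡ suc i
exchange-first A B C i i<A
  rewrite m+n∸m≡n (A + B) C | m+n∸m≡n A B
        | <ᵇ-false (≤-trans (m≤m+n C B) (m≤m+n (C + B) i))
        | <ᵇ-false (m≤m+n (C + B) i)
        | <ᵇ-true (subst (C + B + i <_) (reverse-sum A B C) (+-monoʳ-< (C + B) i<A))
        | m+n∸m≡n (C + B) i = refl

exchange-fixed : ∀ A B C p → suc (A + B + C) ≤ p → exchange A B C p ≡ p
exchange-fixed A B C (suc q) (s≤s A+B+C≤q)
  rewrite m+n∸m≡n (A + B) C | m+n∸m≡n A B
        | <ᵇ-false (≤-trans (m≤n+m C (A + B)) A+B+C≤q)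
        | <ᵇ-false {q} {C + B}
            (≤-trans (subst (C + B ≤_) (reverse-sum A B C) (m≤m+n (C + B) A)) A+B+C≤q)
        | <ᵇ-false A+B+C≤q = refl

record BlockLengths (n j k ℓ : ℕ) : Set where
  constructor lengths
  field
    A B C D : ℕ
    j≡ : j ≡ suc A
    k≡ : k ≡ suc (A + B)
    ℓ≡ : ℓ ≡ suc (A + B + C)
    n≡ : n ≡ A + B + C + D

blockLengths : ∀ {n j k ℓ} → 1 ≤ j → j ≤ k → k ≤ ℓ → ℓ ≤ suc n → BlockLengths n j k ℓ
blockLengths 1≤j j≤k k≤ℓ ℓ≤1+n
  with m≤n⇒∃[o]m+o≡n 1≤j | m≤n⇒∃[o]m+o≡n j≤k | m≤n⇒∃[o]m+o≡n k≤ℓ | m≤n⇒∃[o]m+o≡n ℓ≤1+n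
... | A , refl | B , refl | C , refl | D , ℓ+D≡1+n =
  lengths A B C D refl refl refl (sym (suc-injective ℓ+D≡1+n))

prefixBI-lengths : ∀ {n} (β : PrefixBI n) →
  BlockLengths n (PrefixBI.j β) (PrefixBI.k β) (PrefixBI.ℓ β)
prefixBI-lengths (pbi j k ℓ 1<j j≤k k<ℓ ℓ≤1+n) = blockLengths (<⇒≤ 1<j) j≤k (<⇒≤ k<ℓ) ℓ≤1+n

window-4 : ∀ s A B C D → window s 1 (A + B + C + D) ≡
  window s 1 A + window s (suc A) B + window s (suc (A + B)) C + window s (suc (A + B + C)) D
window-4 s A B C D
  rewrite window-++ s 1 (A + B + C) D | window-++ s 1 (A + B) C | window-++ s 1 A B = refl

three-losses : ∀ {wA wB wC wD vA vB vC vD} →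
  wA ≤ vA + 1 → wB ≤ vB + 1 → wC ≤ vC + 1 → wD ≡ vD →
  wA + wB + wC + wD ≤ vC + vB + vA + vD + 3
three-losses {wA} {wB} {wC} {wD} {vA} {vB} {vC} {vD} hA hB hC refl = begin
    wA + wB + wC + wD
  ≤⟨ +-monoˡ-≤ vD (+-mono-≤ (+-mono-≤ hA hB) hC) ⟩
    (vA + 1) + (vB + 1) + (vC + 1) + vD
  ≡⟨ solve 4 (λ a b c d → (a :+ con 1) :+ (b :+ con 1) :+ (c :+ con 1) :+ d
                         := c :+ b :+ a :+ d :+ con 3) refl vA vB vC vD ⟩
    vC + vB + vA + vD + 3
  ∎
  where open ≤-Reasoning

exchange-breakpoints : ∀ s A B C D →
  window s 1 (A + B + C + D) ≤ window (λ p → s (exchange A B C p)) 1 (A + B + C + D) + 3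
exchange-breakpoints s A B C D = begin
    window s 1 (A + B + C + D)
  ≡⟨ window-4 s A B C D ⟩
    window s 1 A + window s (suc A) B + window s (suc (A + B)) C + window s (suc (A + B + C)) D
  ≤⟨ three-losses
       (window-agree-≤ g (C + B) s 0 A (λ i i<A → cong s (exchange-first A B C i i<A)))
       (window-agree-≤ g C s A B (λ i i<B → cong s (exchange-middle A B C i i<B)))
       (window-agree-≤ g 0 s (A + B) C (λ i i<C → cong s (exchange-second A B C i i<C)))
       tail-unchanged ⟩
    window g 1 C + window g (suc C) B + window g (suc (C + B)) A + window g (suc (C + B + A)) D + 3
  ≡⟨ cong (_+ 3) (sym (window-4 g C B A D)) ⟩
    window g 1 (C + B + A + D) + 3
  ≡⟨ cong (λ m → window g 1 (m + D) + 3) (reverse-sum A B C) ⟩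
    window g 1 (A + B + C + D) + 3
  ∎
  where
  open ≤-Reasoning
  g : ℕ → ℕ
  g p = s (exchange A B C p)
  tail-unchanged : window s (suc (A + B + C)) D ≡ window g (suc (C + B + A)) D
  tail-unchanged = trans
    (sym (window-agree g (A + B + C) s (A + B + C) D
           (λ i _ → cong s (exchange-fixed A B C _ (s≤s (m≤m+n _ i))))))
    (cong (λ m → window g (suc m) D) (sym (reverse-sum A B C)))

prefixBI-breakpoints : ∀ n s (β : PrefixBI n) →
  countBP s (suc n) ≤ countBP (λ p → s (toMap β p)) (suc n) + 3
prefixBI-breakpoints n s β@(pbi j k ℓ _ _ _ _) with prefixBI-lengths β
... | lengths A B C D refl refl refl refl = begin
    countBP s (suc n)
  ≡⟨ countBP-suc s n ⟩
    suc (window s 1 n)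
  ≤⟨ s≤s (exchange-breakpoints s A B C D) ⟩
    suc (window g 1 n) + 3
  ≡⟨ cong (_+ 3) (sym (countBP-suc g n)) ⟩
    countBP g (suc n) + 3
  ∎
  where
  open ≤-Reasoning
  g : ℕ → ℕ
  g p = s (toMap β p)

prefixBI-fixes-end : ∀ n (β : PrefixBI n) → toMap β (suc n) ≡ suc n
prefixBI-fixes-end n β@(pbi j k ℓ _ _ _ ℓ≤1+n) with prefixBI-lengths β
... | lengths A B C D refl refl refl refl = exchange-fixed A B C (suc n) ℓ≤1+n

breakpoints-after : ∀ n s (βs : List (PrefixBI n)) →
  countBP s (suc n) ≤ countBP (applyAll s βs) (suc n) + length βs * 3
breakpoints-after n s []       = ≤-reflexive (sym (+-identityʳ _))
breakpoints-after n s (β ∷ βs) = begin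
    countBP s (suc n)
  ≤⟨ prefixBI-breakpoints n s β ⟩
    countBP s′ (suc n) + 3
  ≤⟨ +-monoˡ-≤ 3 (breakpoints-after n s′ βs) ⟩
    countBP (applyAll s′ βs) (suc n) + length βs * 3 + 3
  ≡⟨ +-assoc _ (length βs * 3) 3 ⟩
    countBP (applyAll s′ βs) (suc n) + (length βs * 3 + 3)
  ≡⟨ cong (countBP (applyAll s′ βs) (suc n) +_) (+-comm (length βs * 3) 3) ⟩
    countBP (applyAll s′ βs) (suc n) + suc (length βs) * 3
  ∎
  where
  open ≤-Reasoning
  s′ : ℕ → ℕ
  s′ p = s (toMap β p)

applyAll-end : ∀ n s (βs : List (PrefixBI n)) → applyAll s βs (suc n) ≡ s (suc n)
applyAll-end n s []       = refl
applyAll-end n s (β ∷ βs) = trans (applyAll-end n _ βs) (cong s (prefixBI-fixes-end n β))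

seq-end : ∀ n (π : Permutation′ n) → seq π (suc n) ≡ suc n
seq-end n π with n <? n
... | yes n<n = ⊥-elim (<-irrefl refl n<n)
... | no  _   = refl

sorted-breakpoints : ∀ n (π : Permutation′ n) (βs : List (PrefixBI n)) → Sorts π βs →
  countBP (applyAll (seq π) βs) (suc n) ≡ 1
sorted-breakpoints n π βs sorts =
  trans (countBP-suc sorted n) (cong suc (window-sorted sorted 0 n identity))
  where
  sorted : ℕ → ℕ
  sorted = applyAll (seq π) βs
  -- Sorts covers positions 1, …, n; position n+1 is the sentinel.
  identity : Agree sorted 0 (λ p → p) 0 (suc n)
  identity i i<1+n with m<1+n⇒m<n∨m≡n i<1+n
  ... | inj₁ i<n  = sorts (suc i) (s≤s z≤n) i<n
  ... | inj₂ refl = trans (applyAll-end n (seq π) βs) (seq-end n π)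

⌈/3⌉-≤ : ∀ {m} t → m ≤ t * 3 → ⌈ m /3⌉ ≤ t
⌈/3⌉-≤ {m} t m≤3t = s≤s⁻¹ (m<n*o⇒m/o<n {m + 2} {suc t} {3} (begin-strict
    m + 2
  ≤⟨ +-monoˡ-≤ 2 m≤3t ⟩
    t * 3 + 2
  <⟨ +-monoʳ-< (t * 3) (n<1+n 2) ⟩
    t * 3 + 3
  ≡⟨ +-comm (t * 3) 3 ⟩
    suc t * 3
  ∎))
  where open ≤-Reasoning

corollary5p3 : (n : ℕ) → 1 ≤ n → (π : Permutation′ n) →
    (βs : List (PrefixBI n)) → Sorts π βs → ⌈ (b π ∸ 1) /3⌉ ≤ length βs
corollary5p3 n _ π βs sorts = ⌈/3⌉-≤ (length βs) (∸-monoˡ-≤ 1 b≤1+3t)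
  where
  -- b(π) ≤ b(πβ₁⋯β_t) + 3t = 1 + 3t.
  b≤1+3t : b π ≤ 1 + length βs * 3
  b≤1+3t = subst (λ x → b π ≤ x + length βs * 3)
                 (sorted-breakpoints n π βs sorts)
                 (breakpoints-after n (seq π) βs)
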